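{- Let $H_1,H_2\in\Theta$. Then $H_1$ and $H_2$ are LG-equivalent if and only if their disjunctive theories coincide, i.e. for every $X\in\Gamma$ and every $T\subseteq\Phi(X)$, the disjunction $T^\vee$ holds in $H_1$ if and only if it holds in $H_2$.
   Context: Fix a variety $\Theta$, an infinite set of variables $X^0$, and let $\Gamma$ be the set of finite subsets of $X^0$; $W(X)$ is the free algebra of $\Theta$ over $X$. For $H\in\Theta$, $\mathrm{Hal}^X_\Theta(H)$ is the Boolean algebra of subsets of $\mathrm{Hom}(W(X),H)$ with quantifiers ($\mu\in\exists xA$ iff some $\nu\in A$ agrees with $\mu$ off $x$), equalities $[w\equiv w']_H=\{\mu:\mu(w)=\mu(w')\}$ and maps $s_*(A)=\{\mu:\mu\circ s\in A\}$ for homomorphisms $s:W(X)\to W(Y)$. The multi-sorted algebra of formulas $\Phi=(\Phi(X),X\in\Gamma)$ is the free Halmos algebra (multi-sorted algebras with sorts extended Boolean algebras with quantifiers $\exists x$, equalities $w\equiv w'$, and operations $s_*$, satisfying the Halmos axioms) over the sets of formal equalities $w\equiv w'$, $w,w'\in W(X)$; $\mathrm{Val}^X_H:\Phi(X)\to\mathrm{Hal}^X_\Theta(H)$ are the components of the unique homomorphism sending $w\equiv w'$ to $[w\equiv w']_H$. A point $\mu:W(X)\to H$ satisfies $u$ iff $\mu\in\mathrm{Val}^X_H(u)$; $\mathrm{LKer}(\mu)$ is the set of formulas satisfied by $\mu$. For $T\subseteq\Phi(X)$, $T^L_H=\{\mu:T\subseteq\mathrm{LKer}(\mu)\}$, for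 $A\subseteq\mathrm{Hom}(W(X),H)$, $A^L_H=\bigcap_{\mu\in A}\mathrm{LKer}(\mu)$, and $T^{LL}_H=(T^L_H)^L_H$. $H_1,H_2$ are LG-equivalent iff $T^{LL}_{H_1}=T^{LL}_{H_2}$ for all $X\in\Gamma$, $T\subseteq\Phi(X)$. For $T\subseteq\Phi(X)$, $T^\vee$ denotes the (possibly infinitary) disjunction of all $u\in T$; it holds in $H$ iff every point $\mu:W(X)\to H$ satisfies at least one $u\in T$. The disjunctive theory of $H$ is the set of all $T^\vee$ ($X\in\Gamma$, $T\subseteq\Phi(X)$) holding in $H$. -}

module Defs where

open import Data.Nat using (ℕ)
open import Data.Fin using (Fin)
open import Data.Product using (Σ; ∃; _×_)
open import Data.Sum using (_⊎_)
open import Data.Empty using (⊥)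
open import Data.Unit using (⊤)
open import Relation.Nullary using (¬_)
open import Relation.Binary.PropositionalEquality using (_≡_; _≢_)

record Signature : Set₁ where
  field
    Op    : Set
    arity : Op → ℕ
open Signature public

-- terms over a set of variables V (representatives of elements of free algebras)
data Term (σ : Signature) (V : Set) : Set where
  var : V → Term σ V
  op  : (f : Op σ) → (Fin (arity σ f) → Term σ V) → Term σ V

record Algebra (σ : Signature) : Set₁ where
  field
    Carrier : Set
    interp  : (f : Op σ) → (Fin (arity σ f) → Carrier) → Carrier
open Algebra public

eval : ∀ {σ V} (H : Algebra σ) → (V → Carrier H) → Term σ V → Carrier H
eval H ρ (var x)   = ρ x
eval H ρ (op f ts) = interp H f (λ i → eval H ρ (ts i))

record Variety : Set₁ where
  field
    sig     : Signature
    Ident   : Set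
    idVars  : Ident → ℕ
    idLeft  : (i : Ident) → Term sig (Fin (idVars i))
    idRight : (i : Ident) → Term sig (Fin (idVars i))
open Variety public

InVariety : (Θ : Variety) → Algebra (sig Θ) → Set
InVariety Θ H = (i : Ident Θ) (ρ : Fin (idVars Θ i) → Carrier H) →
  eval H ρ (idLeft Θ i) ≡ eval H ρ (idRight Θ i)

-- Formulas: the Halmos signature over the formal equalities w ≡ w'.
-- Sorts X ∈ Γ are represented by finite variable sets Fin n.
-- Fml σ n represents elements of Φ(X) for X = Fin n.

data Fml (σ : Signature) : ℕ → Set where
  _≐_  : ∀ {n} → Term σ (Fin n) → Term σ (Fin n) → Fml σ n
  ⊤f   : ∀ {n} → Fml σ n
  ⊥f   : ∀ {n} → Fml σ n
  ¬f   : ∀ {n} → Fml σ n → Fml σ n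
  _∧f_ : ∀ {n} → Fml σ n → Fml σ n → Fml σ n
  _∨f_ : ∀ {n} → Fml σ n → Fml σ n → Fml σ n
  ∃f   : ∀ {n} → Fin n → Fml σ n → Fml σ n
  sub  : ∀ {m n} → (Fin m → Term σ (Fin n)) → Fml σ m → Fml σ n
         -- s_* for the homomorphism s : W(X) → W(Y) given by x ↦ s x

-- Semantics in Hal_Θ(H).  A point μ : W(X) → H is identified with its
-- restriction to the free generators X, i.e. a map Fin n → Carrier H.

Point : ∀ {σ} → Algebra σ → ℕ → Set
Point H n = Fin n → Carrier H

Sat : ∀ {σ} (H : Algebra σ) {n} → Point H n → Fml σ n → Set
Sat H μ (w ≐ w′)  = eval H μ w ≡ eval H μ w′
Sat H μ ⊤f        = ⊤
Sat H μ ⊥f        = ⊥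
Sat H μ (¬f u)    = ¬ Sat H μ u
Sat H μ (u ∧f v)  = Sat H μ u × Sat H μ v
Sat H μ (u ∨f v)  = Sat H μ u ⊎ Sat H μ v
Sat H μ (∃f x u)  = Σ (Point H _) λ ν → ((y : Fin _) → y ≢ x → ν y ≡ μ y) × Sat H ν u
Sat H μ (sub s u) = Sat H (λ x → eval H μ (s x)) u

FSet : Signature → ℕ → Set₁
FSet σ n = Fml σ n → Set

_ᴸ : ∀ {σ n} → FSet σ n → (H : Algebra σ) → Point H n → Set
(T ᴸ) H μ = ∀ u → T u → Sat H μ u

_ᴬᴸ : ∀ {σ n} (H : Algebra σ) → (Point H n → Set) → FSet σ n
(H ᴬᴸ) A u = ∀ μ → A μ → Sat H μ u

_ᴸᴸ : ∀ {σ n} → FSet σ n → (H : Algebra σ) → FSet σ n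
(T ᴸᴸ) H = (H ᴬᴸ) ((T ᴸ) H)

LG-equivalent : ∀ {σ} → Algebra σ → Algebra σ → Set₁
LG-equivalent {σ} H₁ H₂ =
  (n : ℕ) (T : FSet σ n) (u : Fml σ n) →
  ((T ᴸᴸ) H₁ u → (T ᴸᴸ) H₂ u) × ((T ᴸᴸ) H₂ u → (T ᴸᴸ) H₁ u)

DisjHolds : ∀ {σ n} → FSet σ n → Algebra σ → Set
DisjHolds {n = n} T H = (μ : Point H n) → ∃ λ u → T u × Sat H μ u

SameDisjTheory : ∀ {σ} → Algebra σ → Algebra σ → Set₁
SameDisjTheory {σ} H₁ H₂ =
  (n : ℕ) (T : FSet σ n) →
  (DisjHolds T H₁ → DisjHolds T H₂) × (DisjHolds T H₂ → DisjHolds T H₁)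

-- With classical logic, u ∈ T^LL_H says exactly that every point of H satisfies u
-- or the negation of some t ∈ T, i.e. that the disjunction of ¬T ∪ {u} holds in H;
-- conversely T^∨ holds in H iff 0 ∈ (¬T)^LL_H.  So each kind of theory is
-- expressible through the other, uniformly in H.
module Submission where

open import Defs
open import Level using (0ℓ)
open import Axiom.ExcludedMiddle using (ExcludedMiddle)
open import Axiom.DoubleNegationElimination using (DoubleNegationElimination; em⇒dne)
open import Function.Bundles using (_⇔_; mk⇔; Equivalence)
open import Data.Nat using (ℕ)
open import Data.Product using (∃; _×_; _,_)
open import Data.Sum using (inj₁; inj₂)
open import Data.Empty using (⊥-elim)
open import Relation.Nullary using (yes; no)
open import Relation.Unary using (_∪_; ｛_｝)
open import Relation.Binary.PropositionalEquality using (_≡_; refl)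

negations : ∀ {σ n} → FSet σ n → FSet σ n
negations T v = ∃ λ t → T t × v ≡ ¬f t

module _ (em : ExcludedMiddle 0ℓ) {σ : Signature} {n : ℕ} (H : Algebra σ) where

  private
    dne : DoubleNegationElimination 0ℓ
    dne = em⇒dne em

  disjHolds⇔⊥f∈negationsᴸᴸ : (T : FSet σ n) → DisjHolds T H ⇔ (negations T ᴸᴸ) H ⊥f
  disjHolds⇔⊥f∈negationsᴸᴸ T = mk⇔ to from
    where
    to : DisjHolds T H → (negations T ᴸᴸ) H ⊥f
    to d ν ν⊨¬T with d ν
    ... | t , Tt , ν⊨t = ν⊨¬T (¬f t) (t , Tt , refl) ν⊨t

    from : (negations T ᴸᴸ) H ⊥f → DisjHolds T H
    from ll μ = dne λ μ⊭T → ll μ λ { _ (t , Tt , refl) μ⊨t → μ⊭T (t , Tt , μ⊨t) }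

  ᴸᴸ⇔disjHolds : (T : FSet σ n) (u : Fml σ n) →
    (T ᴸᴸ) H u ⇔ DisjHolds (negations T ∪ ｛ u ｝) H
  ᴸᴸ⇔disjHolds T u = mk⇔ to from
    where
    to : (T ᴸᴸ) H u → DisjHolds (negations T ∪ ｛ u ｝) H
    to ll ν with em {Sat H ν u}
    ... | yes ν⊨u = u , inj₂ refl , ν⊨u
    ... | no ν⊭u  = dne λ none →
      ν⊭u (ll ν λ t Tt → dne λ ν⊭t → none (¬f t , inj₁ (t , Tt , refl) , ν⊭t))

    from : DisjHolds (negations T ∪ ｛ u ｝) H → (T ᴸᴸ) H u
    from d μ μ⊨T with d μ
    ... | _ , inj₁ (t , Tt , refl) , μ⊨¬t = ⊥-elim (μ⊨¬t (μ⊨T t Tt))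
    ... | _ , inj₂ refl            , μ⊨u  = μ⊨u

transport-⇔ : {P₁ P₂ Q₁ Q₂ : Set} → Q₁ ⇔ P₁ → Q₂ ⇔ P₂ →
  (P₁ → P₂) × (P₂ → P₁) → (Q₁ → Q₂) × (Q₂ → Q₁)
transport-⇔ Q₁⇔P₁ Q₂⇔P₂ (f , g) =
    (λ q₁ → from Q₂⇔P₂ (f (to Q₁⇔P₁ q₁)))
  , (λ q₂ → from Q₁⇔P₁ (g (to Q₂⇔P₂ q₂)))
  where open Equivalence

proposition3p6 : ExcludedMiddle 0ℓ → (Θ : Variety) (H₁ H₂ : Algebra (sig Θ)) →
    InVariety Θ H₁ → InVariety Θ H₂ →
    LG-equivalent H₁ H₂ ⇔ SameDisjTheory H₁ H₂
proposition3p6 em Θ H₁ H₂ _ _ = mk⇔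
  (λ lg n T → transport-⇔
    (disjHolds⇔⊥f∈negationsᴸᴸ em H₁ T)
    (disjHolds⇔⊥f∈negationsᴸᴸ em H₂ T)
    (lg n (negations T) ⊥f))
  (λ sd n T u → transport-⇔
    (ᴸᴸ⇔disjHolds em H₁ T u)
    (ᴸᴸ⇔disjHolds em H₂ T u)
    (sd n (negations T ∪ ｛ u ｝)))
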